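{- Let $r\ge1$, $a_1,\dots,a_r\in\mathbb{N}$ and $f(x)=(x+a_1)\cdots(x+a_r)$. Then for all $n,k\in\mathbb{N}$, $h_n(f(1),\dots,f(k))$ equals the number of elements $(s_1,\dots,s_r)\in\overline S^k_{k+a_1}\times\cdots\times\overline S^k_{k+a_r}$ such that $s_1,\dots,s_r$ have the same ordered structure and dimension $n$.
   Context: $h_n$ is the complete homogeneous symmetric polynomial of degree $n$. For $m,h\in\mathbb{N}$, $\overline S_m^h$ is the set of ordered lists of $h$ finite sequences $(u^{(1)},\dots,u^{(h)})$, where $u^{(i)}$ is a (possibly empty) finite sequence of integers from $\{i,i+1,\dots,m\}$. Its dimension is the sum of the lengths of $u^{(1)},\dots,u^{(h)}$. Two elements of $\overline S_m^h$ and $\overline S_{m'}^h$ have the same ordered structure if, for every $i$, their $i$-th sequences have the same length. -}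

module Defs where

open import Data.Nat using (ℕ; zero; suc; _+_; _*_; _∸_; _^_; _≤_)
open import Data.Fin using (Fin; toℕ)
open import Data.List using (List; []; _∷_; length; map; concatMap; upTo)
open import Data.Nat.ListAction using (sum; product)
open import Data.List.Relation.Unary.All using (All)
open import Data.Vec using (Vec; []; _∷_; tabulate; toList)
open import Data.Product using (_×_; _,_)
open import Data.Unit using (⊤)
open import Relation.Binary.PropositionalEquality using (_≡_)

weakComps : (k n : ℕ) → List (Vec ℕ k)
weakComps zero    zero    = [] ∷ []
weakComps zero    (suc n) = []
weakComps (suc k) n = concatMap (λ j → map (j ∷_) (weakComps k (n ∸ j))) (upTo (suc n))

monomial : ∀ {k} → Vec ℕ k → Vec ℕ k → ℕ
monomial []       []       = 1
monomial (x ∷ xs) (e ∷ es) = x ^ e * monomial xs es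

hom : (n : ℕ) → ∀ {k} → Vec ℕ k → ℕ
hom n {k} xs = sum (map (monomial xs) (weakComps k n))

polyF : ∀ {r} → Vec ℕ r → ℕ → ℕ
polyF as x = product (map (λ a → x + a) (toList as))

Valid : ∀ {h} → (m lo : ℕ) → Vec (List ℕ) h → Set
Valid m lo []       = ⊤
Valid m lo (u ∷ us) = All (λ x → lo ≤ x × x ≤ m) u × Valid m (suc lo) us

-- S̄_m^h : ordered lists (u⁽¹⁾,…,u⁽ʰ⁾) with u⁽ⁱ⁾ a sequence over {i,…,m}
record SBar (m h : ℕ) : Set where
  constructor sbar
  field
    seqs  : Vec (List ℕ) h
    valid : Valid m 1 seqs
open SBar public

structure : ∀ {m h} → SBar m h → Vec ℕ h
structure s = Data.Vec.map length (seqs s)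

dim : ∀ {m h} → SBar m h → ℕ
dim s = sum (map length (toList (seqs s)))

Tuples : (k : ℕ) → ∀ {r} → Vec ℕ r → Set
Tuples k []       = ⊤
Tuples k (a ∷ as) = SBar (k + a) k × Tuples k as

AllStructDim : (k : ℕ) → ∀ {r} (as : Vec ℕ r) → Vec ℕ k → ℕ → Tuples k as → Set
AllStructDim k []       σ n _        = ⊤
AllStructDim k (a ∷ as) σ n (s , ss) =
  (structure s ≡ σ) × (dim s ≡ n) × AllStructDim k as σ n ss

-- Expanding h_n as a sum of monomials, h_n(f(1),…,f(k)) counts pairs of an
-- exponent vector e with |e| = n and an element of Fin (f(1)^e₁ ⋯ f(k)^e_k).
-- On the other side, an element of S̄^k_{k+a} whose i-th sequence has length
-- σ_i is a choice of σ_i letters from {i,…,k+a}, so there are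
-- ∏_i (k+1-i+a)^σ_i of them; multiplying over a₁,…,a_r gives
-- ∏_i f(k+1-i)^σ_i. Reversing e matches the two descriptions, and the
-- dimension condition only says |σ| = n, which can be pulled out of the
-- product because r ≥ 1.
module Submission where

open import Defs
open import Algebra.Properties.CommutativeSemigroup using (interchange)
open import Data.Fin using (Fin; toℕ; fromℕ<)
open import Data.Fin.Properties using (toℕ-fromℕ<; toℕ-injective; toℕ<n; +↔⊎; *↔×; 1↔⊤)
open import Data.List using (List; []; _∷_; length; map; concatMap; applyUpTo; upTo; _++_)
open import Data.List.Properties using (map-++; map-∘)
open import Data.List.Relation.Unary.All using (All; []; _∷_)
open import Data.Nat using (ℕ; zero; suc; _+_; _*_; _∸_; _^_; _≤_; _<_; z≤n; s≤s; s≤s⁻¹)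
open import Data.Nat.ListAction using (sum)
open import Data.Nat.ListAction.Properties using (sum-++)
open import Data.Nat.Properties
open import Data.Product using (Σ; _×_; _,_; proj₁; proj₂)
open import Data.Product.Function.Dependent.Propositional using (Σ-↔)
open import Data.Product.Function.NonDependent.Propositional using (_×-↔_)
open import Data.Sum using (_⊎_; inj₁; inj₂)
open import Data.Sum.Function.Propositional using (_⊎-↔_)
open import Data.Unit using (⊤; tt)
open import Data.Vec using (Vec; []; _∷_; tabulate; toList; reverse; _∷ʳ_; zipWith; replicate)
import Data.Vec as Vec
open import Data.Vec.Properties using (reverse-∷; reverse-involutive; reverse-reverse)
open import Function using (_∘_)
open import Function.Bundles using (_↔_; mk↔ₛ′; Inverse)
open import Function.Properties.Inverse using (↔-refl; ↔-sym; ↔-trans)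
open import Function.Related.Propositional using (≡⇒)
open import Function.Related.TypeIsomorphisms using (∃∃↔∃∃)
open import Relation.Binary.PropositionalEquality
open import Relation.Nullary using (Irrelevant)

open ≡-Reasoning

Vec-∷↔× : ∀ {A : Set} {l} → Vec A (suc l) ↔ (A × Vec A l)
Vec-∷↔× = mk↔ₛ′ Vec.uncons (λ (x , xs) → x ∷ xs) (λ _ → refl) (λ { (x ∷ xs) → refl })

module _ {A : Set} where

  Vec↔Fin^ : ∀ {c} → A ↔ Fin c → ∀ l → Vec A l ↔ Fin (c ^ l)
  Vec↔Fin^ A↔Fin zero = ↔-sym (↔-trans 1↔⊤ (mk↔ₛ′ (λ _ → []) (λ _ → tt) (λ { [] → refl }) (λ _ → refl)))
  Vec↔Fin^ A↔Fin (suc l) = ↔-trans Vec-∷↔× (↔-trans (A↔Fin ×-↔ Vec↔Fin^ A↔Fin l) (↔-sym *↔×))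

  ∷-≡↔ : ∀ {n} {x y : A} {xs ys : Vec A n} → (x ∷ xs ≡ y ∷ ys) ↔ (x ≡ y × xs ≡ ys)
  ∷-≡↔ = mk↔ₛ′ (λ { refl → refl , refl }) (λ { (refl , refl) → refl })
                (λ { (refl , refl) → refl }) (λ { refl → refl })

  Listⁿ : (A → Set) → ℕ → Set
  Listⁿ P l = Σ (List A) (λ u → All P u × length u ≡ l)

  Listⁿ↔Vec : ∀ {P : A → Set} l → Listⁿ P l ↔ Vec (Σ A P) l
  Listⁿ↔Vec {P} zero = mk↔ₛ′ (λ _ → []) (λ _ → [] , [] , refl) (λ { [] → refl }) (λ { ([] , [] , refl) → refl })
  Listⁿ↔Vec {P} (suc l) = ↔-trans (mk↔ₛ′ to from to-from from-to)
                                   (↔-trans (↔-refl ×-↔ Listⁿ↔Vec l) (↔-sym Vec-∷↔×))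
    where
    to : Listⁿ P (suc l) → Σ A P × Listⁿ P l
    to (x ∷ u , px ∷ pu , r) = (x , px) , (u , pu , suc-injective r)
    from : Σ A P × Listⁿ P l → Listⁿ P (suc l)
    from ((x , px) , (u , pu , r)) = x ∷ u , px ∷ pu , cong suc r
    to-from : ∀ y → to (from y) ≡ y
    to-from ((x , px) , (u , pu , refl)) = refl
    from-to : ∀ y → from (to y) ≡ y
    from-to (x ∷ u , px ∷ pu , r) = cong (λ r′ → x ∷ u , px ∷ pu , r′) (≡-irrelevant _ _)

↔-×-irrelevant : ∀ {A B P : Set} → Irrelevant P → (A → P) → (P → A ↔ B) → A ↔ (P × B)
↔-×-irrelevant {A} {B} {P} irr f A↔B = mk↔ₛ′ to from to-from from-to
  where
  to : A → P × B
  to x = f x , Inverse.to (A↔B (f x)) x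
  from : P × B → A
  from (p , y) = Inverse.from (A↔B p) y
  to-from : ∀ y → to (from y) ≡ y
  to-from (p , y) with f (from (p , y)) | irr (f (from (p , y))) p
  ... | .p | refl = cong (p ,_) (Inverse.strictlyInverseˡ (A↔B p) y)
  from-to : ∀ x → from (to x) ≡ x
  from-to x = Inverse.strictlyInverseʳ (A↔B (f x)) x

-- h_n as a count of weighted weak compositions

Weighted : (k n : ℕ) → (Vec ℕ k → ℕ) → Set
Weighted k n w = Σ (Vec ℕ k) (λ e → Vec.sum e ≡ n × Fin (w e))

sum-map-concatMap : ∀ {A B : Set} (w : B → ℕ) (f : A → List B) xs →
  sum (map w (concatMap f xs)) ≡ sum (map (sum ∘ map w ∘ f) xs)
sum-map-concatMap w f [] = refl
sum-map-concatMap w f (x ∷ xs) = begin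
  sum (map w (f x ++ concatMap f xs))              ≡⟨ cong sum (map-++ w (f x) (concatMap f xs)) ⟩
  sum (map w (f x) ++ map w (concatMap f xs))      ≡⟨ sum-++ (map w (f x)) _ ⟩
  sum (map w (f x)) + sum (map w (concatMap f xs)) ≡⟨ cong (sum (map w (f x)) +_) (sum-map-concatMap w f xs) ⟩
  sum (map (sum ∘ map w ∘ f) (x ∷ xs))             ∎

Fin-sum-map-applyUpTo : ∀ (F f : ℕ → ℕ) N →
  Fin (sum (map F (applyUpTo f N))) ↔ Σ ℕ (λ j → j < N × Fin (F (f j)))
Fin-sum-map-applyUpTo F f zero = mk↔ₛ′ (λ ()) (λ { (j , () , _) }) (λ { (j , () , _) }) (λ ())
Fin-sum-map-applyUpTo F f (suc N) =
  ↔-trans +↔⊎ (↔-trans (↔-refl ⊎-↔ Fin-sum-map-applyUpTo F (f ∘ suc) N) (mk↔ₛ′ to from to-from from-to))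
  where
  Rest : Set
  Rest = Σ ℕ (λ j → j < N × Fin (F (f (suc j))))
  to : Fin (F (f 0)) ⊎ Rest → Σ ℕ (λ j → j < suc N × Fin (F (f j)))
  to (inj₁ x) = 0 , s≤s z≤n , x
  to (inj₂ (j , p , x)) = suc j , s≤s p , x
  from : Σ ℕ (λ j → j < suc N × Fin (F (f j))) → Fin (F (f 0)) ⊎ Rest
  from (zero , p , x) = inj₁ x
  from (suc j , s≤s p , x) = inj₂ (j , p , x)
  to-from : ∀ y → to (from y) ≡ y
  to-from (zero , s≤s z≤n , x) = refl
  to-from (suc j , s≤s p , x) = refl
  from-to : ∀ y → from (to y) ≡ y
  from-to (inj₁ x) = refl
  from-to (inj₂ y) = refl

Weighted-∷↔ : ∀ {k} n (w : Vec ℕ (suc k) → ℕ) →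
  Σ ℕ (λ j → j < suc n × Weighted k (n ∸ j) (w ∘ (j ∷_))) ↔ Weighted (suc k) n w
Weighted-∷↔ {k} n w = mk↔ₛ′ to from to-from from-to
  where
  to : Σ ℕ (λ j → j < suc n × Weighted k (n ∸ j) (w ∘ (j ∷_))) → Weighted (suc k) n w
  to (j , p , e , q , x) = j ∷ e , trans (cong (j +_) q) (m+[n∸m]≡n (s≤s⁻¹ p)) , x
  from : Weighted (suc k) n w → Σ ℕ (λ j → j < suc n × Weighted k (n ∸ j) (w ∘ (j ∷_)))
  from (j ∷ e , r , x) =
    j , s≤s (subst (j ≤_) r (m≤m+n j (Vec.sum e))) , e , trans (sym (m+n∸m≡n j (Vec.sum e))) (cong (_∸ j) r) , x
  to-from : ∀ y → to (from y) ≡ y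
  to-from (j ∷ e , r , x) = cong (λ r′ → j ∷ e , r′ , x) (≡-irrelevant _ _)
  from-to : ∀ y → from (to y) ≡ y
  from-to (j , p , e , q , x) = cong₂ (λ p′ q′ → j , p′ , e , q′ , x) (≤-irrelevant _ _) (≡-irrelevant _ _)

Fin-sum-weakComps : ∀ k n (w : Vec ℕ k → ℕ) → Fin (sum (map w (weakComps k n))) ↔ Weighted k n w
Fin-sum-weakComps zero zero w = ↔-trans (≡⇒ (cong Fin (+-identityʳ (w []))))
  (mk↔ₛ′ (λ x → [] , refl , x) (λ { ([] , refl , x) → x }) (λ { ([] , refl , x) → refl }) (λ x → refl))
Fin-sum-weakComps zero (suc n) w = mk↔ₛ′ (λ ()) (λ { ([] , () , _) }) (λ { ([] , () , _) }) (λ ())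
Fin-sum-weakComps (suc k) n w =
  ↔-trans (≡⇒ (cong Fin (sum-map-concatMap w (λ j → map (j ∷_) (weakComps k (n ∸ j))) (upTo (suc n)))))
  (↔-trans (Fin-sum-map-applyUpTo (λ j → sum (map w (map (j ∷_) (weakComps k (n ∸ j))))) (λ j → j) (suc n))
  (↔-trans (Σ-↔ ↔-refl λ {j} → ↔-refl ×-↔
              ↔-trans (≡⇒ (cong (Fin ∘ sum) (sym (map-∘ (weakComps k (n ∸ j))))))
                      (Fin-sum-weakComps k (n ∸ j) (w ∘ (j ∷_))))
  (Weighted-∷↔ n w)))

-- Reversing the variables

sum-∷ʳ : ∀ {k} (xs : Vec ℕ k) x → Vec.sum (xs ∷ʳ x) ≡ Vec.sum xs + x
sum-∷ʳ []       x = +-identityʳ x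
sum-∷ʳ (y ∷ ys) x = trans (cong (y +_) (sum-∷ʳ ys x)) (sym (+-assoc y (Vec.sum ys) x))

sum-reverse : ∀ {k} (xs : Vec ℕ k) → Vec.sum (reverse xs) ≡ Vec.sum xs
sum-reverse []       = refl
sum-reverse (x ∷ xs) = begin
  Vec.sum (reverse (x ∷ xs))    ≡⟨ cong Vec.sum (reverse-∷ x xs) ⟩
  Vec.sum (reverse xs ∷ʳ x)     ≡⟨ sum-∷ʳ (reverse xs) x ⟩
  Vec.sum (reverse xs) + x      ≡⟨ cong (_+ x) (sum-reverse xs) ⟩
  Vec.sum xs + x                ≡⟨ +-comm (Vec.sum xs) x ⟩
  Vec.sum (x ∷ xs)              ∎

monomial-∷ʳ : ∀ {k} (xs es : Vec ℕ k) x e → monomial (xs ∷ʳ x) (es ∷ʳ e) ≡ monomial xs es * x ^ e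
monomial-∷ʳ []       []       x e = trans (*-identityʳ (x ^ e)) (sym (*-identityˡ (x ^ e)))
monomial-∷ʳ (y ∷ ys) (d ∷ ds) x e =
  trans (cong (y ^ d *_) (monomial-∷ʳ ys ds x e)) (sym (*-assoc (y ^ d) (monomial ys ds) (x ^ e)))

monomial-reverse : ∀ {k} (xs es : Vec ℕ k) → monomial (reverse xs) (reverse es) ≡ monomial xs es
monomial-reverse []       []       = refl
monomial-reverse (x ∷ xs) (e ∷ es) = begin
  monomial (reverse (x ∷ xs)) (reverse (e ∷ es))   ≡⟨ cong₂ monomial (reverse-∷ x xs) (reverse-∷ e es) ⟩
  monomial (reverse xs ∷ʳ x) (reverse es ∷ʳ e)     ≡⟨ monomial-∷ʳ (reverse xs) (reverse es) x e ⟩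
  monomial (reverse xs) (reverse es) * x ^ e       ≡⟨ cong (_* x ^ e) (monomial-reverse xs es) ⟩
  monomial xs es * x ^ e                           ≡⟨ *-comm (monomial xs es) (x ^ e) ⟩
  monomial (x ∷ xs) (e ∷ es)                       ∎

Weighted-reverse : ∀ {k} n (xs : Vec ℕ k) → Weighted k n (monomial xs) ↔ Weighted k n (monomial (reverse xs))
Weighted-reverse n xs =
  Σ-↔ (mk↔ₛ′ reverse reverse reverse-involutive reverse-involutive) λ {e} →
    ≡⇒ (cong (_≡ n) (sym (sum-reverse e))) ×-↔ ≡⇒ (cong Fin (sym (monomial-reverse xs e)))

tabulateDown : ∀ {A : Set} → (ℕ → A) → (k : ℕ) → Vec A k
tabulateDown F zero    = []
tabulateDown F (suc k) = F (suc k) ∷ tabulateDown F k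

reverse-∷ʳ : ∀ {A : Set} {k} (xs : Vec A k) x → reverse (xs ∷ʳ x) ≡ x ∷ reverse xs
reverse-∷ʳ xs x = reverse-reverse (trans (reverse-∷ x (reverse xs)) (cong (_∷ʳ x) (reverse-involutive xs)))

tabulate-toℕ-∷ʳ : ∀ {A : Set} (F : ℕ → A) k → tabulate {n = suc k} (F ∘ toℕ) ≡ tabulate (F ∘ toℕ) ∷ʳ F k
tabulate-toℕ-∷ʳ F zero    = refl
tabulate-toℕ-∷ʳ F (suc k) = cong (F 0 ∷_) (tabulate-toℕ-∷ʳ (F ∘ suc) k)

reverse-tabulate : ∀ {A : Set} (F : ℕ → A) k → reverse (tabulate {n = k} (F ∘ suc ∘ toℕ)) ≡ tabulateDown F k
reverse-tabulate F zero    = refl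
reverse-tabulate F (suc k) = begin
  reverse (tabulate (F ∘ suc ∘ toℕ))              ≡⟨ cong reverse (tabulate-toℕ-∷ʳ (F ∘ suc) k) ⟩
  reverse (tabulate (F ∘ suc ∘ toℕ) ∷ʳ F (suc k)) ≡⟨ reverse-∷ʳ (tabulate (F ∘ suc ∘ toℕ)) (F (suc k)) ⟩
  F (suc k) ∷ reverse (tabulate (F ∘ suc ∘ toℕ))  ≡⟨ cong (F (suc k) ∷_) (reverse-tabulate F k) ⟩
  tabulateDown F (suc k)                          ∎

^-distrib-* : ∀ x y l → (x * y) ^ l ≡ x ^ l * y ^ l
^-distrib-* x y zero    = refl
^-distrib-* x y (suc l) =
  trans (cong (x * y *_) (^-distrib-* x y l)) (interchange *-commutativeSemigroup x y (x ^ l) (y ^ l))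

monomial-zipWith-* : ∀ {k} (xs ys es : Vec ℕ k) →
  monomial (zipWith _*_ xs ys) es ≡ monomial xs es * monomial ys es
monomial-zipWith-* []       []       []       = refl
monomial-zipWith-* (x ∷ xs) (y ∷ ys) (e ∷ es) = begin
  (x * y) ^ e * monomial (zipWith _*_ xs ys) es
    ≡⟨ cong₂ _*_ (^-distrib-* x y e) (monomial-zipWith-* xs ys es) ⟩
  (x ^ e * y ^ e) * (monomial xs es * monomial ys es)
    ≡⟨ interchange *-commutativeSemigroup (x ^ e) (y ^ e) (monomial xs es) (monomial ys es) ⟩
  monomial (x ∷ xs) (e ∷ es) * monomial (y ∷ ys) (e ∷ es)
    ∎

monomial-replicate-1 : ∀ {k} (es : Vec ℕ k) → monomial (replicate k 1) es ≡ 1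
monomial-replicate-1 []       = refl
monomial-replicate-1 (e ∷ es) = cong₂ _*_ (^-zeroˡ e) (monomial-replicate-1 es)

tabulateDown-zipWith : ∀ {A B C : Set} (_∙_ : A → B → C) F G k →
  tabulateDown (λ x → F x ∙ G x) k ≡ zipWith _∙_ (tabulateDown F k) (tabulateDown G k)
tabulateDown-zipWith _∙_ F G zero    = refl
tabulateDown-zipWith _∙_ F G (suc k) = cong (F (suc k) ∙ G (suc k) ∷_) (tabulateDown-zipWith _∙_ F G k)

tabulateDown-const : ∀ {A : Set} (c : A) k → tabulateDown (λ _ → c) k ≡ replicate k c
tabulateDown-const c zero    = refl
tabulateDown-const c (suc k) = cong (c ∷_) (tabulateDown-const c k)

monomial-polyF-[] : ∀ k (es : Vec ℕ k) → monomial (tabulateDown (polyF []) k) es ≡ 1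
monomial-polyF-[] k es = trans (cong (λ xs → monomial xs es) (tabulateDown-const 1 k)) (monomial-replicate-1 es)

monomial-polyF-∷ : ∀ {r} a (as : Vec ℕ r) k (es : Vec ℕ k) →
  monomial (tabulateDown (polyF (a ∷ as)) k) es
    ≡ monomial (tabulateDown (_+ a) k) es * monomial (tabulateDown (polyF as) k) es
monomial-polyF-∷ a as k es =
  trans (cong (λ xs → monomial xs es) (tabulateDown-zipWith _*_ (_+ a) (polyF as) k))
        (monomial-zipWith-* (tabulateDown (_+ a) k) (tabulateDown (polyF as) k) es)

-- Counting elements of S̄ with a given ordered structure

Between : ℕ → ℕ → Set
Between lo m = Σ ℕ (λ x → lo ≤ x × x ≤ m)

Between-≡ : ∀ {lo m} {x y : Between lo m} → proj₁ x ≡ proj₁ y → x ≡ y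
Between-≡ {x = x , _} {.x , _} refl = cong (x ,_) (cong₂ _,_ (≤-irrelevant _ _) (≤-irrelevant _ _))

m<n∸o⇒o+m<n : ∀ m n o → m < n ∸ o → o + m < n
m<n∸o⇒o+m<n m n       zero    p = p
m<n∸o⇒o+m<n m zero    (suc o) ()
m<n∸o⇒o+m<n m (suc n) (suc o) p = s≤s (m<n∸o⇒o+m<n m n o p)

Between↔Fin : ∀ lo m → Between lo m ↔ Fin (suc m ∸ lo)
Between↔Fin lo m = mk↔ₛ′ to from to-from from-to
  where
  to : Between lo m → Fin (suc m ∸ lo)
  to (x , lo≤x , x≤m) = fromℕ< (∸-monoˡ-< (s≤s x≤m) lo≤x)
  from : Fin (suc m ∸ lo) → Between lo m
  from i = lo + toℕ i , m≤m+n lo (toℕ i) , s≤s⁻¹ (m<n∸o⇒o+m<n (toℕ i) (suc m) lo (toℕ<n i))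
  to-from : ∀ i → to (from i) ≡ i
  to-from i = toℕ-injective (trans (toℕ-fromℕ< _) (m+n∸m≡n lo (toℕ i)))
  from-to : ∀ y → from (to y) ≡ y
  from-to (x , lo≤x , x≤m) = Between-≡ (trans (cong (lo +_) (toℕ-fromℕ< _)) (m+[n∸m]≡n lo≤x))

Fibre : ∀ {h} → ℕ → ℕ → Vec ℕ h → Set
Fibre {h} m lo σ = Σ (Vec (List ℕ) h) (λ v → Valid m lo v × Vec.map length v ≡ σ)

Fibre-∷↔ : ∀ {h} m lo l (σ : Vec ℕ h) →
  Fibre m lo (l ∷ σ) ↔ (Listⁿ (λ x → lo ≤ x × x ≤ m) l × Fibre m (suc lo) σ)
Fibre-∷↔ m lo l σ = mk↔ₛ′ to from to-from from-to
  where
  lengths↔ : ∀ u v → (length u ∷ Vec.map length v ≡ l ∷ σ) ↔ (length u ≡ l × Vec.map length v ≡ σ)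
  lengths↔ u v = ∷-≡↔
  to : Fibre m lo (l ∷ σ) → Listⁿ (λ x → lo ≤ x × x ≤ m) l × Fibre m (suc lo) σ
  to (u ∷ v , (pu , pv) , r) = let (r₁ , r₂) = Inverse.to (lengths↔ u v) r in (u , pu , r₁) , (v , pv , r₂)
  from : Listⁿ (λ x → lo ≤ x × x ≤ m) l × Fibre m (suc lo) σ → Fibre m lo (l ∷ σ)
  from ((u , pu , r) , (v , pv , rs)) = u ∷ v , (pu , pv) , Inverse.from (lengths↔ u v) (r , rs)
  to-from : ∀ y → to (from y) ≡ y
  to-from ((u , pu , r) , (v , pv , rs)) =
    cong (λ p → (u , pu , proj₁ p) , (v , pv , proj₂ p)) (Inverse.strictlyInverseˡ (lengths↔ u v) (r , rs))
  from-to : ∀ y → from (to y) ≡ y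
  from-to (u ∷ v , (pu , pv) , r) = cong (λ r′ → u ∷ v , (pu , pv) , r′) (Inverse.strictlyInverseʳ (lengths↔ u v) r)

intervalSizes : ℕ → ℕ → (h : ℕ) → Vec ℕ h
intervalSizes m lo zero    = []
intervalSizes m lo (suc h) = (suc m ∸ lo) ∷ intervalSizes m (suc lo) h

Fibre↔Fin : ∀ {h} m lo (σ : Vec ℕ h) → Fibre m lo σ ↔ Fin (monomial (intervalSizes m lo h) σ)
Fibre↔Fin m lo [] = ↔-sym (↔-trans 1↔⊤ (mk↔ₛ′ (λ _ → [] , tt , refl) (λ _ → tt) (λ { ([] , tt , refl) → refl }) (λ _ → refl)))
Fibre↔Fin m lo (l ∷ σ) =
  ↔-trans (Fibre-∷↔ m lo l σ)
  (↔-trans ((↔-trans (Listⁿ↔Vec l) (Vec↔Fin^ (Between↔Fin lo m) l)) ×-↔ Fibre↔Fin m (suc lo) σ)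
  (↔-sym *↔×))

intervalSizes-+ : ∀ t a j → intervalSizes (j + a + t) (suc t) j ≡ tabulateDown (_+ a) j
intervalSizes-+ t a zero    = refl
intervalSizes-+ t a (suc j) = cong₂ _∷_ (m+n∸n≡m (suc j + a) t) (begin
  intervalSizes (suc (j + a + t)) (suc (suc t)) j ≡⟨ cong (λ m → intervalSizes m (suc (suc t)) j) (sym (+-suc (j + a) t)) ⟩
  intervalSizes (j + a + suc t) (suc (suc t)) j   ≡⟨ intervalSizes-+ (suc t) a j ⟩
  tabulateDown (_+ a) j                           ∎)

SBar-structure↔Fin : ∀ k a (σ : Vec ℕ k) →
  Σ (SBar (k + a) k) (λ s → structure s ≡ σ) ↔ Fin (monomial (tabulateDown (_+ a) k) σ)
SBar-structure↔Fin k a σ =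
  ↔-trans (mk↔ₛ′ (λ (sbar v p , r) → v , p , r) (λ (v , p , r) → sbar v p , r) (λ _ → refl) (λ _ → refl))
  (↔-trans (Fibre↔Fin (k + a) 1 σ)
  (≡⇒ (cong (λ xs → Fin (monomial xs σ)) (begin
    intervalSizes (k + a) 1 k     ≡⟨ cong (λ m → intervalSizes m 1 k) (sym (+-identityʳ (k + a))) ⟩
    intervalSizes (k + a + 0) 1 k ≡⟨ intervalSizes-+ 0 a k ⟩
    tabulateDown (_+ a) k         ∎))))

-- Tuples with common ordered structure and dimension

sum-map-toList : ∀ {A : Set} {h} (f : A → ℕ) (v : Vec A h) → sum (map f (toList v)) ≡ Vec.sum (Vec.map f v)
sum-map-toList f []       = refl
sum-map-toList f (x ∷ xs) = cong (f x +_) (sum-map-toList f xs)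

dim≡sum∘structure : ∀ {m h} (s : SBar m h) → dim s ≡ Vec.sum (structure s)
dim≡sum∘structure s = sum-map-toList length (seqs s)

StructDimTuples : (k : ℕ) → ∀ {r} → Vec ℕ r → Vec ℕ k → ℕ → Set
StructDimTuples k as σ n = Σ (Tuples k as) (AllStructDim k as σ n)

StructDimTuples↔Fin : ∀ {k r n} {σ : Vec ℕ k} (as : Vec ℕ r) → Vec.sum σ ≡ n →
  StructDimTuples k as σ n ↔ Fin (monomial (tabulateDown (polyF as) k) σ)
StructDimTuples↔Fin {k} {σ = σ} [] _ =
  ↔-trans (mk↔ₛ′ (λ _ → tt) (λ _ → tt , tt) (λ _ → refl) (λ _ → refl))
  (↔-trans (↔-sym 1↔⊤) (≡⇒ (cong Fin (sym (monomial-polyF-[] k σ)))))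
StructDimTuples↔Fin {k} {n = n} {σ} (a ∷ as) Σσ≡n =
  ↔-trans (mk↔ₛ′ to from (λ _ → refl) (λ _ → refl))
  (↔-trans ((Σ-↔ ↔-refl (λ {s} → dim-redundant {s})) ×-↔ ↔-refl)
  (↔-trans (SBar-structure↔Fin k a σ ×-↔ StructDimTuples↔Fin as Σσ≡n)
  (↔-trans (↔-sym *↔×) (≡⇒ (cong Fin (sym (monomial-polyF-∷ a as k σ)))))))
  where
  Head : Set
  Head = Σ (SBar (k + a) k) (λ s → structure s ≡ σ × dim s ≡ n)
  to : StructDimTuples k (a ∷ as) σ n → Head × StructDimTuples k as σ n
  to ((s , ss) , p , d , w) = (s , p , d) , (ss , w)
  from : Head × StructDimTuples k as σ n → StructDimTuples k (a ∷ as) σ n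
  from ((s , p , d) , (ss , w)) = (s , ss) , p , d , w
  dim-redundant : ∀ {s : SBar (k + a) k} → (structure s ≡ σ × dim s ≡ n) ↔ structure s ≡ σ
  dim-redundant {s} = mk↔ₛ′ proj₁ (λ p → p , trans (dim≡sum∘structure s) (trans (cong Vec.sum p) Σσ≡n))
    (λ _ → refl) (λ (p , d) → cong (p ,_) (≡-irrelevant _ _))

StructDimTuples-sum : ∀ {k r n} {σ : Vec ℕ k} a (as : Vec ℕ r) → StructDimTuples k (a ∷ as) σ n → Vec.sum σ ≡ n
StructDimTuples-sum a as ((s , _) , refl , d , _) = trans (sym (dim≡sum∘structure s)) d

propositionP : (r : ℕ) → 1 ≤ r → (a : Vec ℕ r) → (n k : ℕ) →
    Fin (hom n (tabulate {n = k} (λ i → polyF a (suc (toℕ i)))))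
      ↔ Σ (Tuples k a) (λ s → Σ (Vec ℕ k) (λ σ → AllStructDim k a σ n s))
propositionP (suc r) _ (a ∷ as) n k =
  ↔-trans (Fin-sum-weakComps k n (monomial xs))
  (↔-trans (Weighted-reverse n xs)
  (↔-trans (≡⇒ (cong (λ ys → Weighted k n (monomial ys)) (reverse-tabulate (polyF (a ∷ as)) k)))
  (↔-trans (Σ-↔ ↔-refl (↔-sym (↔-×-irrelevant ≡-irrelevant (StructDimTuples-sum a as)
                                                 (StructDimTuples↔Fin (a ∷ as)))))
  (∃∃↔∃∃ _))))
  where
  xs : Vec ℕ k
  xs = tabulate (λ i → polyF (a ∷ as) (suc (toℕ i)))
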